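{- Let $S$ be a sequent of $G^{+}_{Grz}$ with closure $Cl(S)=\{S_1,\ldots,S_n\}$, and let $\Lambda,\Theta,\Omega$ be arbitrary finite multisets of formulas. Then: (1) $S$ is derivable in $G^{+}_{Grz}$ from the premises $S_1,\ldots,S_n$, and if $\vdash_{G^{+}_{Grz}}S$ then $\vdash_{G^{+}_{Grz}}S_i$ for each $i$; (2) $S(\Lambda|\Theta;\Omega)$ is derivable in $G^{+}_{Grz}$ from $S_1(\Lambda|\Theta;\Omega),\ldots,S_n(\Lambda|\Theta;\Omega)$, and if $\vdash_{G^{+}_{Grz}}S(\Lambda|\Theta;\Omega)$ then $\vdash_{G^{+}_{Grz}}S_i(\Lambda|\Theta;\Omega)$ for each $i$.
   Context: Formulas are built from propositional variables and $\bot$ by $\neg,\wedge,\vee,\Box$; $\alpha\to\beta:=\neg\alpha\vee\beta$; $\Box\Gamma$ is the multiset $\Gamma$ with each element prefixed by $\Box$; $D(\alpha):=\Box(\alpha\to\Box\alpha)$. Sequents of $G^{+}_{Grz}$ have the form $\Box\Sigma|\Gamma\Rightarrow\Delta$ with $\Sigma,\Gamma,\Delta$ finite multisets of formulas. Axioms: $\Box\Sigma|\Gamma,p\Rightarrow p,\Delta$ ($p$ a propositional variable) and $\Box\Sigma|\Gamma,\bot\Rightarrow\Delta$. Propositional rules (with $\Box\Sigma$ unchanged): $\wedge$-l from $\Box\Sigma|\Gamma,\alpha,\beta\Rightarrow\Delta$ to $\Box\Sigma|\Gamma,\alpha\wedge\beta\Rightarrow\Delta$; $\vee$-r from $\Box\Sigma|\Gamma\Rightarrow\alpha,\beta,\Delta$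 to $\Box\Sigma|\Gamma\Rightarrow\alpha\vee\beta,\Delta$; $\neg$-r from $\Box\Sigma|\Gamma,\alpha\Rightarrow\Delta$ to $\Box\Sigma|\Gamma\Rightarrow\neg\alpha,\Delta$; $\neg$-l from $\Box\Sigma|\Gamma\Rightarrow\alpha,\Delta$ to $\Box\Sigma|\Gamma,\neg\alpha\Rightarrow\Delta$; $\wedge$-r from $\Box\Sigma|\Gamma\Rightarrow\alpha,\Delta$ and $\Box\Sigma|\Gamma\Rightarrow\beta,\Delta$ to $\Box\Sigma|\Gamma\Rightarrow\alpha\wedge\beta,\Delta$; $\vee$-l from $\Box\Sigma|\Gamma,\alpha\Rightarrow\Delta$ and $\Box\Sigma|\Gamma,\beta\Rightarrow\Delta$ to $\Box\Sigma|\Gamma,\alpha\vee\beta\Rightarrow\Delta$. Modal rules: $\Box^{+}_{T}$: from $\Box\alpha,\Box\Sigma|\Gamma,\alpha\Rightarrow\Delta$ infer $\Box\Sigma|\Gamma,\Box\alpha\Rightarrow\Delta$; $\Box^{+}_{Grz1}$: from $\Box\Gamma|\emptyset\Rightarrow\alpha$ infer $\Box\Gamma|\Pi\Rightarrow\Box\alpha,\Delta$ provided $D(\alpha)\in\Box\Gamma$; $\Box^{+}_{Grz2}$: from $\Box\Gamma,D(\alpha)|\Gamma\Rightarrow\alpha$ infer $\Box\Gamma|\Pi\Rightarrow\Box\alpha,\Delta$ provided $D(\alpha)\notin\Box\Gamma$; in both, $\Pi$ contains only propositional variables and $\Delta$ only propositional variables and boxed formulas. The invertible rules are the six propositional rules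 and $\Box^{+}_{T}$. A sequent is critical if no invertible rule can be applied backwards to it. The closure $Cl(S)$ is the set of critical sequents in the smallest set of sequents containing $S$ and closed under backward applications of the invertible rules. For $S=(\Box\Sigma|\Gamma\Rightarrow\Delta)$ and finite multisets $\Lambda,\Theta,\Omega$, $S(\Lambda|\Theta;\Omega)$ denotes $\Box\Sigma,\Box\Lambda|\Gamma,\Theta\Rightarrow\Delta,\Omega$. -}

module Defs where

open import Data.Nat using (ℕ)
open import Data.List using (List; []; _∷_; _++_; [_])
open import Data.List.Membership.Propositional using (_∈_; _∉_)
open import Data.List.Relation.Unary.All using (All)
open import Data.List.Relation.Binary.Permutation.Propositional using (_↭_)
open import Data.Product using (_×_; Σ; _,_)
open import Data.Sum using (_⊎_)
open import Data.Empty using (⊥)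
open import Relation.Nullary using (¬_)

data Fm : Set where
  var : ℕ → Fm
  bot : Fm
  neg : Fm → Fm
  _∧'_ : Fm → Fm → Fm
  _∨'_ : Fm → Fm → Fm
  box : Fm → Fm

_⇒'_ : Fm → Fm → Fm
α ⇒' β = neg α ∨' β

-- D(α) = □(α → □α); in a sequent the boxed part □Σ is stored as Σ,
-- so D(α) ∈ □Σ  iff  (α → □α) ∈ Σ.
Dbody : Fm → Fm
Dbody α = α ⇒' box α

-- A sequent □Σ | Γ ⇒ Δ; multisets are lists, compared up to permutation.
-- The field bx stores Σ (the formulas under the boxes of □Σ).
infix 4 _∣_⇛_
record Seq : Set where
  constructor _∣_⇛_
  field
    bx  : List Fm
    ant : List Fm
    suc : List Fm

_≈S_ : Seq → Seq → Set
(Σ₁ ∣ Γ₁ ⇛ Δ₁) ≈S (Σ₂ ∣ Γ₂ ⇛ Δ₂) = (Σ₁ ↭ Σ₂) × (Γ₁ ↭ Γ₂) × (Δ₁ ↭ Δ₂)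

_∈S_ : Seq → List Seq → Set
S ∈S [] = ⊥
S ∈S (T ∷ Ts) = (S ≈S T) ⊎ (S ∈S Ts)

data IsVar : Fm → Set where
  isVar : ∀ n → IsVar (var n)

data VarOrBox : Fm → Set where
  isVar : ∀ n → VarOrBox (var n)
  isBox : ∀ α → VarOrBox (box α)

data InvRule : List Seq → Seq → Set where
  ∧l : ∀ {B Γ Γ₀ Δ α β} → Γ ↭ ((α ∧' β) ∷ Γ₀) →
       InvRule [ B ∣ α ∷ β ∷ Γ₀ ⇛ Δ ] (B ∣ Γ ⇛ Δ)
  ∨r : ∀ {B Γ Δ Δ₀ α β} → Δ ↭ ((α ∨' β) ∷ Δ₀) →
       InvRule [ B ∣ Γ ⇛ α ∷ β ∷ Δ₀ ] (B ∣ Γ ⇛ Δ)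
  ¬r : ∀ {B Γ Δ Δ₀ α} → Δ ↭ (neg α ∷ Δ₀) →
       InvRule [ B ∣ α ∷ Γ ⇛ Δ₀ ] (B ∣ Γ ⇛ Δ)
  ¬l : ∀ {B Γ Γ₀ Δ α} → Γ ↭ (neg α ∷ Γ₀) →
       InvRule [ B ∣ Γ₀ ⇛ α ∷ Δ ] (B ∣ Γ ⇛ Δ)
  ∧r : ∀ {B Γ Δ Δ₀ α β} → Δ ↭ ((α ∧' β) ∷ Δ₀) →
       InvRule ((B ∣ Γ ⇛ α ∷ Δ₀) ∷ (B ∣ Γ ⇛ β ∷ Δ₀) ∷ []) (B ∣ Γ ⇛ Δ)
  ∨l : ∀ {B Γ Γ₀ Δ α β} → Γ ↭ ((α ∨' β) ∷ Γ₀) →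
       InvRule ((B ∣ α ∷ Γ₀ ⇛ Δ) ∷ (B ∣ β ∷ Γ₀ ⇛ Δ) ∷ []) (B ∣ Γ ⇛ Δ)
  □T : ∀ {B Γ Γ₀ Δ α} → Γ ↭ (box α ∷ Γ₀) →
       InvRule [ α ∷ B ∣ α ∷ Γ₀ ⇛ Δ ] (B ∣ Γ ⇛ Δ)

data Rule : List Seq → Seq → Set where
  axVar : ∀ {B Γ Γ₀ Δ Δ₀ n} → Γ ↭ (var n ∷ Γ₀) → Δ ↭ (var n ∷ Δ₀) →
          Rule [] (B ∣ Γ ⇛ Δ)
  axBot : ∀ {B Γ Γ₀ Δ} → Γ ↭ (bot ∷ Γ₀) → Rule [] (B ∣ Γ ⇛ Δ)
  inv   : ∀ {ps S} → InvRule ps S → Rule ps S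
  grz1  : ∀ {G Π Δ Δ₀ α} → Dbody α ∈ G → All IsVar Π → All VarOrBox Δ₀ →
          Δ ↭ (box α ∷ Δ₀) →
          Rule [ G ∣ [] ⇛ [ α ] ] (G ∣ Π ⇛ Δ)
  grz2  : ∀ {G Π Δ Δ₀ α} → Dbody α ∉ G → All IsVar Π → All VarOrBox Δ₀ →
          Δ ↭ (box α ∷ Δ₀) →
          Rule [ Dbody α ∷ G ∣ G ⇛ [ α ] ] (G ∣ Π ⇛ Δ)

data Deriv (P : Seq → Set) : Seq → Set where
  prem : ∀ {S T} → S ≈S T → P T → Deriv P S
  rule : ∀ {ps S} → Rule ps S → All (Deriv P) ps → Deriv P S

_⊢from_ : List Seq → Seq → Set
Ss ⊢from S = Deriv (λ T → T ∈S Ss) S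

⊢ : Seq → Set
⊢ S = Deriv (λ _ → ⊥) S

Critical : Seq → Set
Critical S = ∀ ps → ¬ InvRule ps S

data Reach (S : Seq) : Seq → Set where
  here : Reach S S
  step : ∀ {T ps U} → Reach S T → InvRule ps T → U Data.List.Membership.Propositional.∈ ps →
         Reach S U

InCl : Seq → Seq → Set
InCl S T = Reach S T × Critical T

-- Ss is an enumeration of Cl(S) (as a set of sequents, up to ≈S)
IsClosure : Seq → List Seq → Set
IsClosure S Ss = ∀ T → (InCl S T → T ∈S Ss) × (T ∈S Ss → Σ Seq λ U → InCl S U × (T ≈S U))

-- S(Λ|Θ;Ω) = □Σ,□Λ | Γ,Θ ⇒ Δ,Ω
ext : Seq → List Fm → List Fm → List Fm → Seq
ext (B ∣ Γ ⇛ Δ) Λ Θ Ω = (B ++ Λ) ∣ (Γ ++ Θ) ⇛ (Δ ++ Ω)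

{-# OPTIONS --safe #-}
-- An invertible rule can be permuted above any inference: the formula it decomposes is either
-- the principal formula of that inference, whose premise is then the sequent sought, or passive
-- in it, and then the rule is applied to its premises instead. Inverting an axiom gives an
-- axiom, since the atoms it rests on are passive, and the conclusions of the Grz rules contain no
-- formula that an invertible rule decomposes. So provability is inherited along backward
-- invertible steps. Backward invertible steps also terminate, as the components of a formula
-- weigh less than the formula, and the critical sequents they end in are exactly Cl(S). Adding
-- Λ, Θ, Ω to every sequent commutes with all invertible rules, and (1) is the case of empty
-- Λ, Θ, Ω.
module Submission where

open import Defs
open import Data.List using (List; map; []; _∷_; _++_; [_])
open import Data.List.Membership.Propositional using (_∈_)
open import Data.List.Membership.Propositional using (_∉_)
open import Data.Product using (_×_)

open import Data.Empty using (⊥; ⊥-elim)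
open import Data.Nat using (ℕ; suc; _+_; _<_; s≤s)
open import Data.Nat.Induction using (<-wellFounded)
open import Data.Nat.ListAction using (sum)
open import Data.Nat.ListAction.Properties using (sum-++; sum-↭)
open import Data.Nat.Properties
  using (≤-refl; m≤m+n; m≤n+m; +-assoc; +-identityʳ; +-monoˡ-<; +-commutativeSemigroup;
         module ≤-Reasoning)
open import Algebra.Properties.CommutativeSemigroup +-commutativeSemigroup
  using () renaming (interchange to +-interchange; x∙yz≈y∙xz to +-exchange)
open import Data.Product using (∃; ∃-syntax; _,_; proj₁; proj₂)
open import Data.Sum using (_⊎_; inj₁; inj₂)
open import Data.List.Properties using (++-assoc; ++-identityʳ; map-++)
open import Data.List.Membership.Propositional.Properties using (∈-map⁺; ∈-map⁻; ∈-++⁺ʳ; ∈-∃++)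
open import Data.List.Relation.Unary.All as All using (All; []; _∷_)
open import Data.List.Relation.Unary.All.Properties using (map⁺)
open import Data.List.Relation.Unary.Any using (here; there)
open import Data.List.Relation.Binary.Permutation.Propositional
  using (_↭_; ↭-refl; ↭-sym; ↭-trans; ↭-prep; ↭-swap; ↭-reflexive)
open import Data.List.Relation.Binary.Permutation.Propositional.Properties
  using (All-resp-↭; ∈-resp-↭; ++⁺ˡ; ++⁺ʳ; shift; shifts; drop-∷)
  renaming (map⁺ to ↭-map⁺)
open import Induction.WellFounded using (Acc; acc)
open import Relation.Binary.PropositionalEquality using (_≡_; refl; sym; subst; cong₂)

data Side : Set where
  left right : Side

private
  variable
    n : ℕ
    x y : Fm
    xs ys R : List Fm
    s s' : Side
    S T U T₀ T₁ c d E : Seq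
    ps : List Seq
    Q : Seq → Set

∈⇒↭∷ : x ∈ xs → ∃ λ ys → xs ↭ x ∷ ys
∈⇒↭∷ x∈ with as , bs , refl ← ∈-∃++ x∈ = as ++ bs , shift _ as bs

↭∷⇒∈ : xs ↭ x ∷ ys → x ∈ xs
↭∷⇒∈ p = ∈-resp-↭ (↭-sym p) (here refl)

∷-↭-∷ : x ∷ xs ↭ y ∷ ys → (x ≡ y × xs ↭ ys) ⊎ ∃ λ zs → xs ↭ y ∷ zs × ys ↭ x ∷ zs
∷-↭-∷ p with ↭∷⇒∈ p
... | here refl = inj₁ (refl , drop-∷ p)
... | there y∈xs with ∈-∃++ y∈xs
...   | as , bs , refl = inj₂ (as ++ bs , shift _ as bs ,
        drop-∷ (↭-trans (↭-sym p) (↭-trans (↭-prep _ (shift _ as bs)) (↭-swap _ _ ↭-refl))))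

infixl 25 _⊕_
infixl 30 _[_≔_]

_⊕_ : Seq → Seq → Seq
(B ∣ Γ ⇛ Δ) ⊕ (B′ ∣ Γ′ ⇛ Δ′) = (B ++ B′) ∣ (Γ ++ Γ′) ⇛ (Δ ++ Δ′)

side : Side → Seq → List Fm
side left  = Seq.ant
side right = Seq.suc

_[_≔_] : Seq → Side → List Fm → Seq
(B ∣ Γ ⇛ Δ) [ left  ≔ Γ′ ] = B ∣ Γ′ ⇛ Δ
(B ∣ Γ ⇛ Δ) [ right ≔ Δ′ ] = B ∣ Γ ⇛ Δ′

ε : Seq
ε = [] ∣ [] ⇛ []

put : Side → Fm → Seq → Seq
put left  x (B ∣ Γ ⇛ Δ) = B ∣ x ∷ Γ ⇛ Δ
put right x (B ∣ Γ ⇛ Δ) = B ∣ Γ ⇛ x ∷ Δ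

≈S-refl : T ≈S T
≈S-refl = ↭-refl , ↭-refl , ↭-refl

≈S-sym : T ≈S U → U ≈S T
≈S-sym (eB , eΓ , eΔ) = ↭-sym eB , ↭-sym eΓ , ↭-sym eΔ

≈S-trans : S ≈S T → T ≈S U → S ≈S U
≈S-trans (eB , eΓ , eΔ) (eB′ , eΓ′ , eΔ′) = ↭-trans eB eB′ , ↭-trans eΓ eΓ′ , ↭-trans eΔ eΔ′

side-resp-≈S : ∀ s → T ≈S U → side s T ↭ side s U
side-resp-≈S left  (_ , eΓ , _) = eΓ
side-resp-≈S right (_ , _ , eΔ) = eΔ

∈-resp-≈S : ∀ s → x ∈ side s T → T ≈S U → x ∈ side s U
∈-resp-≈S s x∈ e = ∈-resp-↭ (side-resp-≈S s e) x∈

∈-put⁻ : ∀ s' → y ∈ side s' (put s x T) → (s ≡ s' × y ≡ x) ⊎ y ∈ side s' T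
∈-put⁻ {s = left}  left  (here refl) = inj₁ (refl , refl)
∈-put⁻ {s = left}  left  (there y∈)  = inj₂ y∈
∈-put⁻ {s = right} right (here refl) = inj₁ (refl , refl)
∈-put⁻ {s = right} right (there y∈)  = inj₂ y∈
∈-put⁻ {s = left}  right y∈          = inj₂ y∈
∈-put⁻ {s = right} left  y∈          = inj₂ y∈

∈-⊕⁺ʳ : ∀ s → y ∈ side s T → y ∈ side s (c ⊕ T)
∈-⊕⁺ʳ {c = c} left  = ∈-++⁺ʳ (Seq.ant c)
∈-⊕⁺ʳ {c = c} right = ∈-++⁺ʳ (Seq.suc c)

put-set : ∀ s → side s T ↭ x ∷ R → T ≈S put s x (T [ s ≔ R ])
put-set left  p = ↭-refl , p , ↭-refl
put-set right p = ↭-refl , ↭-refl , p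

≈put⇒side : ∀ s → T ≈S put s x T₀ → side s T ↭ x ∷ side s T₀
≈put⇒side left  (_ , eΓ , _) = eΓ
≈put⇒side right (_ , _ , eΔ) = eΔ

≈put⇒rest : ∀ s → T ≈S put s x T₀ → T [ s ≔ side s T₀ ] ≈S T₀
≈put⇒rest left  (eB , _ , eΔ) = eB , ↭-refl , eΔ
≈put⇒rest right (eB , eΓ , _) = eB , eΓ , ↭-refl

put-split : ∀ s s' → put s x T₀ ≈S put s' y T₁ →
  (s ≡ s' × x ≡ y × T₀ ≈S T₁) ⊎ ∃ λ T₂ → T₀ ≈S put s' y T₂ × T₁ ≈S put s x T₂
put-split left  left  (eB , eΓ , eΔ) with ∷-↭-∷ eΓ
... | inj₁ (refl , eΓ′) = inj₁ (refl , refl , eB , eΓ′ , eΔ)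
... | inj₂ (Γ₂ , p , q) = inj₂ ((_ ∣ Γ₂ ⇛ _) , (↭-refl , p , ↭-refl) , (↭-sym eB , q , ↭-sym eΔ))
put-split right right (eB , eΓ , eΔ) with ∷-↭-∷ eΔ
... | inj₁ (refl , eΔ′) = inj₁ (refl , refl , eB , eΓ , eΔ′)
... | inj₂ (Δ₂ , p , q) = inj₂ ((_ ∣ _ ⇛ Δ₂) , (↭-refl , ↭-refl , p) , (↭-sym eB , ↭-sym eΓ , q))
put-split left  right (eB , eΓ , eΔ) =
  inj₂ ((_ ∣ _ ⇛ _) , (↭-refl , ↭-refl , eΔ) , (↭-sym eB , ↭-sym eΓ , ↭-refl))
put-split right left  (eB , eΓ , eΔ) =
  inj₂ ((_ ∣ _ ⇛ _) , (↭-refl , eΓ , ↭-refl) , (↭-sym eB , ↭-refl , ↭-sym eΔ))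

⊕-congˡ : ∀ c → T ≈S U → c ⊕ T ≈S c ⊕ U
⊕-congˡ c (eB , eΓ , eΔ) = ++⁺ˡ (Seq.bx c) eB , ++⁺ˡ (Seq.ant c) eΓ , ++⁺ˡ (Seq.suc c) eΔ

⊕-congʳ : ∀ E → T ≈S U → T ⊕ E ≈S U ⊕ E
⊕-congʳ E (eB , eΓ , eΔ) = ++⁺ʳ (Seq.bx E) eB , ++⁺ʳ (Seq.ant E) eΓ , ++⁺ʳ (Seq.suc E) eΔ

⊕-assoc : ∀ c T E → c ⊕ T ⊕ E ≈S c ⊕ (T ⊕ E)
⊕-assoc c T E = ↭-reflexive (++-assoc (Seq.bx c) _ _) , ↭-reflexive (++-assoc (Seq.ant c) _ _) ,
                ↭-reflexive (++-assoc (Seq.suc c) _ _)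

⊕-exchange : ∀ c d T → c ⊕ (d ⊕ T) ≈S d ⊕ (c ⊕ T)
⊕-exchange c d T =
  shifts (Seq.bx c) (Seq.bx d) , shifts (Seq.ant c) (Seq.ant d) , shifts (Seq.suc c) (Seq.suc d)

⊕-identityʳ : T ⊕ ε ≈S T
⊕-identityʳ {T} = ↭-reflexive (++-identityʳ (Seq.bx T)) , ↭-reflexive (++-identityʳ (Seq.ant T)) ,
                  ↭-reflexive (++-identityʳ (Seq.suc T))

⊕-put : ∀ s c → c ⊕ put s x T ≈S put s x (c ⊕ T)
⊕-put left  c = ↭-refl , shift _ (Seq.ant c) _ , ↭-refl
⊕-put right c = ↭-refl , ↭-refl , shift _ (Seq.suc c) _

≈put-⊕ : ∀ s E → T ≈S put s x T₀ → T ⊕ E ≈S put s x (T₀ ⊕ E)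
≈put-⊕ left  E = ⊕-congʳ E
≈put-⊕ right E = ⊕-congʳ E

∈⇒∈S : T ∈ ps → T ∈S ps
∈⇒∈S (here refl) = inj₁ ≈S-refl
∈⇒∈S (there T∈)  = inj₂ (∈⇒∈S T∈)

∈S-map : ∀ E → T ∈S ps → T ⊕ E ∈S map (_⊕ E) ps
∈S-map {ps = _ ∷ _} E (inj₁ T≈U)  = inj₁ (⊕-congʳ E T≈U)
∈S-map {ps = _ ∷ _} E (inj₂ T∈S) = inj₂ (∈S-map E T∈S)

-- An invertible rule with principal formula x on side s of its conclusion T has the premises
-- c ⊕ T₀ for c ∈ components s x, where T₀ is T with that occurrence of x removed.
components : Side → Fm → List Seq
components left  (α ∧' β) = [ [] ∣ α ∷ β ∷ [] ⇛ [] ]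
components left  (α ∨' β) = ([] ∣ [ α ] ⇛ []) ∷ ([] ∣ [ β ] ⇛ []) ∷ []
components left  (neg α)  = [ [] ∣ [] ⇛ [ α ] ]
components left  (box α)  = [ [ α ] ∣ [ α ] ⇛ [] ]
components left  (var _)  = []
components left  bot      = []
components right (α ∧' β) = ([] ∣ [] ⇛ [ α ]) ∷ ([] ∣ [] ⇛ [ β ]) ∷ []
components right (α ∨' β) = [ [] ∣ [] ⇛ α ∷ β ∷ [] ]
components right (neg α)  = [ [] ∣ [ α ] ⇛ [] ]
components right (var _)  = []
components right bot      = []
components right (box _)  = []

components-nonempty : c ∈ components s x → components s x ≡ [] → ⊥
components-nonempty c∈ empty with () ← subst (_ ∈_) empty c∈

InvRule-intro : ∀ s → side s T ↭ x ∷ R → c ∈ components s x →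
                InvRule (map (_⊕ T [ s ≔ R ]) (components s x)) T
InvRule-intro {x = _ ∧' _} left  p _ = ∧l p
InvRule-intro {x = _ ∨' _} left  p _ = ∨l p
InvRule-intro {x = neg _}  left  p _ = ¬l p
InvRule-intro {x = box _}  left  p _ = □T p
InvRule-intro {x = _ ∧' _} right p _ = ∧r p
InvRule-intro {x = _ ∨' _} right p _ = ∨r p
InvRule-intro {x = neg _}  right p _ = ¬r p

data InvRuleView (ps : List Seq) (T : Seq) : Set where
  principal : ∀ s x T₀ {c} → T ≈S put s x T₀ → c ∈ components s x →
              ps ≡ map (_⊕ T₀) (components s x) → InvRuleView ps T

InvRule-view : InvRule ps T → InvRuleView ps T
InvRule-view (∧l p) = principal left  _ _ (put-set left p) (here refl) refl
InvRule-view (∨r p) = principal right _ _ (put-set right p) (here refl) refl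
InvRule-view (¬r p) = principal right _ _ (put-set right p) (here refl) refl
InvRule-view (¬l p) = principal left  _ _ (put-set left p) (here refl) refl
InvRule-view (∧r p) = principal right _ _ (put-set right p) (here refl) refl
InvRule-view (∨l p) = principal left  _ _ (put-set left p) (here refl) refl
InvRule-view (□T p) = principal left  _ _ (put-set left p) (here refl) refl

Passive : Side → Fm → Set
Passive s x = components s x ≡ []

Inert : Seq → Set
Inert T = ∀ s → All (Passive s) (side s T)

Inert⇒no-principal : Inert T → T ≈S put s x T₀ → c ∉ components s x
Inert⇒no-principal {s = s} inert e c∈ =
  components-nonempty c∈ (All.lookup (inert s) (↭∷⇒∈ (≈put⇒side s e)))

HasPrincipal : Side → List Fm → Set
HasPrincipal s xs = ∃[ x ] ∃[ R ] xs ↭ x ∷ R × ∃[ c ] c ∈ components s x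

principal? : ∀ s xs → HasPrincipal s xs ⊎ All (Passive s) xs
principal? s [] = inj₂ []
principal? s (y ∷ ys) with components s y in eq
... | c ∷ _ = inj₁ (y , ys , ↭-refl , c , subst (c ∈_) (sym eq) (here refl))
... | [] with principal? s ys
...   | inj₁ (x , R , p , c∈) = inj₁ (x , y ∷ R , ↭-trans (↭-prep y p) (↭-swap y x ↭-refl) , c∈)
...   | inj₂ passive = inj₂ (eq ∷ passive)

reducible? : ∀ T → (∃[ s ] HasPrincipal s (side s T)) ⊎ Inert T
reducible? T with principal? left (side left T) | principal? right (side right T)
... | inj₁ h      | _          = inj₁ (left , h)
... | inj₂ _      | inj₁ h     = inj₁ (right , h)
... | inj₂ inertL | inj₂ inertR = inj₂ λ { left → inertL ; right → inertR }

Inert⇒Critical : Inert T → Critical T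
Inert⇒Critical inert _ r with InvRule-view r
... | principal _ _ _ e c∈ _ = Inert⇒no-principal inert e c∈

grz-conclusion-inert : ∀ {G Π Δ Δ₀ α} → All IsVar Π → All VarOrBox Δ₀ → Δ ↭ box α ∷ Δ₀ →
                       Inert (G ∣ Π ⇛ Δ)
grz-conclusion-inert vars _ _ left = All.map (λ { (isVar _) → refl }) vars
grz-conclusion-inert _ vbs p right =
  All-resp-↭ (↭-sym p) (refl ∷ All.map (λ { (isVar _) → refl ; (isBox _) → refl }) vbs)

axiom-var : var n ∈ side left T → var n ∈ side right T → Deriv Q T
axiom-var {T = _ ∣ _ ⇛ _} inL inR = rule (axVar (proj₂ (∈⇒↭∷ inL)) (proj₂ (∈⇒↭∷ inR))) []

axiom-bot : bot ∈ side left T → Deriv Q T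
axiom-bot {T = _ ∣ _ ⇛ _} inL = rule (axBot (proj₂ (∈⇒↭∷ inL))) []

Deriv-resp-≈S : S ≈S T → Deriv Q S → Deriv Q T
premises-resp-≈S : ∀ cs → T₀ ≈S T₁ → All (Deriv Q) (map (_⊕ T₀) cs) → All (Deriv Q) (map (_⊕ T₁) cs)
InvRule-apply : T ≈S put s x T₀ → c ∈ components s x →
                All (Deriv Q) (map (_⊕ T₀) (components s x)) → Deriv Q T

Deriv-resp-≈S e (prem e′ q) = prem (≈S-trans (≈S-sym e) e′) q
Deriv-resp-≈S e (rule (axVar p q) []) =
  axiom-var (∈-resp-≈S left (↭∷⇒∈ p) e) (∈-resp-≈S right (↭∷⇒∈ q) e)
Deriv-resp-≈S e (rule (axBot p) []) = axiom-bot (∈-resp-≈S left (↭∷⇒∈ p) e)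
Deriv-resp-≈S e (rule (inv r) ds) with InvRule-view r
... | principal s x T₀ e′ c∈ refl = InvRule-apply (≈S-trans (≈S-sym e) e′) c∈ ds
Deriv-resp-≈S (eB , eΓ , eΔ) (rule (grz1 D∈ vars vbs p) (d ∷ [])) =
  rule (grz1 (∈-resp-↭ eB D∈) (All-resp-↭ eΓ vars) vbs (↭-trans (↭-sym eΔ) p))
       (Deriv-resp-≈S (eB , ↭-refl , ↭-refl) d ∷ [])
Deriv-resp-≈S (eB , eΓ , eΔ) (rule (grz2 D∉ vars vbs p) (d ∷ [])) =
  rule (grz2 (λ D∈ → D∉ (∈-resp-↭ (↭-sym eB) D∈)) (All-resp-↭ eΓ vars) vbs (↭-trans (↭-sym eΔ) p))
       (Deriv-resp-≈S (↭-prep _ eB , eB , ↭-refl) d ∷ [])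

premises-resp-≈S []       _ []       = []
premises-resp-≈S (c ∷ cs) e (d ∷ ds) = Deriv-resp-≈S (⊕-congˡ c e) d ∷ premises-resp-≈S cs e ds

InvRule-apply {s = s} e c∈ ds =
  rule (inv (InvRule-intro s (≈put⇒side s e) c∈)) (premises-resp-≈S _ (≈S-sym (≈put⇒rest s e)) ds)


∈-survives : ∀ s' → T ≈S put s x T₀ → c ∈ components s x → Passive s' y →
             y ∈ side s' T → y ∈ side s' (c ⊕ T₀)
∈-survives {s = s} s' e c∈ passive y∈ with ∈-put⁻ {s = s} s' (∈-resp-≈S s' y∈ e)
... | inj₁ (refl , refl) = ⊥-elim (components-nonempty c∈ passive)
... | inj₂ y∈T₀         = ∈-⊕⁺ʳ s' y∈T₀

Invertible : Seq → Set
Invertible T = ∀ {s x T₀ c} → T ≈S put s x T₀ → c ∈ components s x → ⊢ (c ⊕ T₀)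

⊢⇒Invertible : ⊢ T → Invertible T
⊢-premises⇒Invertible : All ⊢ ps → All Invertible ps

-- Either the occurrence to be inverted is the principal formula of r, and the wanted sequent is
-- a premise of r, or it is passive in r, and r is applied below the inverted premises of r.
InvRule-permutes : InvRule ps T → All ⊢ ps → All Invertible ps → Invertible T
InvRule-permutes r ds invs {s = s} {c = c} e c∈ with InvRule-view r
... | principal s′ y T₁ e′ c′∈ refl with put-split s s′ (≈S-trans (≈S-sym e) e′)
...   | inj₁ (refl , refl , T₀≈T₁) =
  Deriv-resp-≈S (⊕-congˡ c (≈S-sym T₀≈T₁)) (All.lookup ds (∈-map⁺ _ c∈))
...   | inj₂ (T₂ , T₀≈ , T₁≈) =
  Deriv-resp-≈S (≈S-sym (≈S-trans (⊕-congˡ c T₀≈) (⊕-put s′ c)))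
    (InvRule-apply ≈S-refl c′∈ (map⁺ (All.tabulate λ {d} d∈ →
      Deriv-resp-≈S (⊕-exchange c d T₂)
        (All.lookup invs (∈-map⁺ _ d∈) (≈S-trans (⊕-congˡ d T₁≈) (⊕-put s d)) c∈))))

⊢⇒Invertible (prem _ ())
⊢⇒Invertible (rule (axVar p q) []) {s} e c∈ =
  axiom-var (∈-survives {s = s} left e c∈ refl (↭∷⇒∈ p))
            (∈-survives {s = s} right e c∈ refl (↭∷⇒∈ q))
⊢⇒Invertible (rule (axBot p) []) {s} e c∈ = axiom-bot (∈-survives {s = s} left e c∈ refl (↭∷⇒∈ p))
⊢⇒Invertible (rule (inv r) ds) = InvRule-permutes r ds (⊢-premises⇒Invertible ds)
⊢⇒Invertible (rule (grz1 _ vars vbs p) _) e c∈ =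
  ⊥-elim (Inert⇒no-principal (grz-conclusion-inert vars vbs p) e c∈)
⊢⇒Invertible (rule (grz2 _ vars vbs p) _) e c∈ =
  ⊥-elim (Inert⇒no-principal (grz-conclusion-inert vars vbs p) e c∈)

⊢-premises⇒Invertible []       = []
⊢-premises⇒Invertible (d ∷ ds) = ⊢⇒Invertible d ∷ ⊢-premises⇒Invertible ds

⊢-Reach : ∀ E → ⊢ (S ⊕ E) → Reach S T → ⊢ (T ⊕ E)
⊢-Reach E ⊢S here = ⊢S
⊢-Reach E ⊢S (step reach r U∈) with InvRule-view r
... | principal s x T₀ e _ refl with ∈-map⁻ _ U∈
...   | d , d∈ , refl =
  Deriv-resp-≈S (≈S-sym (⊕-assoc d T₀ E)) (⊢⇒Invertible (⊢-Reach E ⊢S reach) (≈put-⊕ s E e) d∈)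

size : Fm → ℕ
size (var _)  = 1
size bot      = 1
size (neg α)  = suc (size α)
size (α ∧' β) = suc (size α + size β)
size (α ∨' β) = suc (size α + size β)
size (box α)  = suc (size α)

sizes : List Fm → ℕ
sizes xs = sum (map size xs)

-- The boxed part is not counted: □T moves a formula into it.
weight : Seq → ℕ
weight (_ ∣ Γ ⇛ Δ) = sizes Γ + sizes Δ

sizes-++ : ∀ xs ys → sizes (xs ++ ys) ≡ sizes xs + sizes ys
sizes-++ xs ys rewrite map-++ size xs ys = sum-++ (map size xs) (map size ys)

sizes-↭ : xs ↭ ys → sizes xs ≡ sizes ys
sizes-↭ p = sum-↭ (↭-map⁺ size p)

weight-resp-≈S : T ≈S U → weight T ≡ weight U
weight-resp-≈S (_ , eΓ , eΔ) = cong₂ _+_ (sizes-↭ eΓ) (sizes-↭ eΔ)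

weight-⊕ : ∀ c T → weight (c ⊕ T) ≡ weight c + weight T
weight-⊕ (_ ∣ Γ ⇛ Δ) (_ ∣ Γ′ ⇛ Δ′) rewrite sizes-++ Γ Γ′ | sizes-++ Δ Δ′ =
  +-interchange (sizes Γ) (sizes Γ′) (sizes Δ) (sizes Δ′)

weight-put : ∀ s x T → weight (put s x T) ≡ size x + weight T
weight-put left  x (_ ∣ Γ ⇛ Δ) = +-assoc (size x) (sizes Γ) (sizes Δ)
weight-put right x (_ ∣ Γ ⇛ Δ) = +-exchange (sizes Γ) (size x) (sizes Δ)

components-lighter : ∀ s x → c ∈ components s x → weight c < size x
components-lighter left (α ∧' β) (here refl)
  rewrite +-identityʳ (size β) | +-identityʳ (size α + size β) = ≤-refl
components-lighter left (α ∨' β) (here refl)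
  rewrite +-identityʳ (size α) | +-identityʳ (size α) = s≤s (m≤m+n (size α) (size β))
components-lighter left (α ∨' β) (there (here refl))
  rewrite +-identityʳ (size β) | +-identityʳ (size β) = s≤s (m≤n+m (size β) (size α))
components-lighter left (neg α) (here refl) rewrite +-identityʳ (size α) = ≤-refl
components-lighter left (box α) (here refl)
  rewrite +-identityʳ (size α) | +-identityʳ (size α) = ≤-refl
components-lighter right (α ∧' β) (here refl)
  rewrite +-identityʳ (size α) = s≤s (m≤m+n (size α) (size β))
components-lighter right (α ∧' β) (there (here refl))
  rewrite +-identityʳ (size β) = s≤s (m≤n+m (size β) (size α))
components-lighter right (α ∨' β) (here refl) rewrite +-identityʳ (size β) = ≤-refl
components-lighter right (neg α) (here refl)
  rewrite +-identityʳ (size α) | +-identityʳ (size α) = ≤-refl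

weight-decreases : ∀ s x → T ≈S put s x T₀ → c ∈ components s x → weight (c ⊕ T₀) < weight T
weight-decreases {T} {T₀} {c} s x e c∈ = begin-strict
  weight (c ⊕ T₀)      ≡⟨ weight-⊕ c T₀ ⟩
  weight c + weight T₀ <⟨ +-monoˡ-< (weight T₀) (components-lighter s x c∈) ⟩
  size x + weight T₀   ≡⟨ weight-put s x T₀ ⟨
  weight (put s x T₀)  ≡⟨ weight-resp-≈S e ⟨
  weight T             ∎
  where open ≤-Reasoning

module _ {S E : Seq} {Q : Seq → Set} (critical : ∀ {T} → InCl S T → Deriv Q (T ⊕ E)) where

  Reach⇒Deriv : ∀ T → Acc _<_ (weight T) → Reach S T → Deriv Q (T ⊕ E)
  Reach⇒Deriv T (acc smaller) reach with reducible? T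
  ... | inj₂ inert = critical (reach , Inert⇒Critical inert)
  ... | inj₁ (s , x , R , p , c , c∈) =
    InvRule-apply (≈put-⊕ s E (put-set s p)) c∈ (map⁺ (All.tabulate λ {d} d∈ →
      Deriv-resp-≈S (⊕-assoc d (T [ s ≔ R ]) E)
        (Reach⇒Deriv (d ⊕ T [ s ≔ R ]) (smaller (weight-decreases s x (put-set s p) d∈))
          (step reach (InvRule-intro s p c∈) (∈-map⁺ _ d∈)))))

  closure⇒Deriv : Deriv Q (S ⊕ E)
  closure⇒Deriv = Reach⇒Deriv S (<-wellFounded (weight S)) here

closure-invertible : ∀ {Ss} E → IsClosure S Ss → ⊢ (S ⊕ E) → ∀ {Si} → Si ∈ Ss → ⊢ (Si ⊕ E)
closure-invertible E cl ⊢S Si∈ with proj₂ (cl _) (∈⇒∈S Si∈)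
... | U , (reach , _) , Si≈U = Deriv-resp-≈S (⊕-congʳ E (≈S-sym Si≈U)) (⊢-Reach E ⊢S reach)

lemma2p12 : (S : Seq) (Ss : List Seq) → IsClosure S Ss →
    (Λ Θ Ω : List Fm) →
    ((Ss ⊢from S) × (⊢ S → ∀ {Si} → Si ∈ Ss → ⊢ Si))
    × ((map (λ T → ext T Λ Θ Ω) Ss ⊢from ext S Λ Θ Ω)
       × (⊢ (ext S Λ Θ Ω) → ∀ {Si} → Si ∈ Ss → ⊢ (ext Si Λ Θ Ω)))
lemma2p12 S Ss cl Λ Θ Ω =
  ( Deriv-resp-≈S ⊕-identityʳ (closure⇒Deriv λ inCl → prem ⊕-identityʳ (inClosure inCl))
  , λ ⊢S Si∈ → Deriv-resp-≈S ⊕-identityʳ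
                 (closure-invertible ε cl (Deriv-resp-≈S (≈S-sym ⊕-identityʳ) ⊢S) Si∈) )
  , ( closure⇒Deriv (λ inCl → prem ≈S-refl (∈S-map (Λ ∣ Θ ⇛ Ω) (inClosure inCl)))
    , closure-invertible (Λ ∣ Θ ⇛ Ω) cl )
  where
  inClosure : ∀ {T} → InCl S T → T ∈S Ss
  inClosure {T} = proj₁ (cl T)
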